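{- Let $k\ge 3$ be odd and let $N$ be the largest odd number such that $N\le k/3$. Then there is a minion homomorphism from $\mathrm{Pol}(\mathbf C_k,\mathbf K_3)$ to $\mathcal Z_{\le N}$.
   Context: Graphs are loopless. $\mathbf C_m$ is the $m$-cycle with vertex set $\{0,1,\dots,m-1\}$, two vertices adjacent iff they differ by exactly $1$ modulo $m$; $\mathbf K_3=\mathbf C_3$. The $n$-th direct power $\mathbf G^n$ has vertex set $V(G)^n$, with $((u_1,\dots,u_n),(v_1,\dots,v_n))$ an edge iff $(u_i,v_i)\in E(G)$ for all $i$. An $n$-ary polymorphism from $\mathbf G$ to $\mathbf H$ is a graph homomorphism $\mathbf G^n\to\mathbf H$; $\mathrm{Pol}(\mathbf G,\mathbf H)$ is the set of all polymorphisms of all arities $n\ge1$. An $n$-ary function $f\colon A^n\to B$ is a minor of an $m$-ary $g\colon A^m\to B$ given by $\pi\colon\{1,\dots,m\}\to\{1,\dots,n\}$ if $f(x_1,\dots,x_n)=g(x_{\pi(1)},\dots,x_{\pi(m)})$ for all $x_i\in A$. A (function) minion on $(A,B)$ is a nonempty set of functions $A^n\to B$ ($n\ge1$) closed under taking minors. A minion homomorphism $\xi\colon\mathcal M\to\mathcal N$ is a map that preserves arities and satisfies $\xi(g)(x_{\pi(1)},\dots,x_{\pi(m)})=\xi(g(x_{\pi(1)},\dots,x_{\pi(m)}))$ for all $m$-ary $g\in\mathcal M$ and all $\pi\colon\{1,\dots,m\}\to\{1,\dots,n\}$ (i.e., $\xi$ maps the minor of $g$ given by $\pi$ to the minor of $\xi(g)$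 given by $\pi$). For odd $N$, $\mathcal Z_{\le N}$ is the set of all functions $f\colon\mathbb Z^n\to\mathbb Z$ ($n\ge1$) of the form $f(x_1,\dots,x_n)=c_1x_1+\dots+c_nx_n$ with $c_i\in\mathbb Z$, $\sum_i|c_i|\le N$, and $\sum_i c_i$ odd. -}

module Defs where

open import Data.Nat using (ℕ; zero; suc; _+_; _*_; _≤_; _<_; NonZero; _%_)
open import Data.Fin using (Fin; toℕ; zero; suc)
open import Data.Integer as ℤ using (ℤ; ∣_∣)
open import Data.Product using (Σ; _×_; _,_)
open import Data.Sum using (_⊎_)
open import Function using (_∘_)
open import Relation.Binary.PropositionalEquality using (_≡_)

-- Adjacency in the m-cycle C_m on {0,…,m-1}: a and b differ by exactly 1 mod m.
-- K_3 = C_3, i.e. CAdj 3.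
CAdj : (m : ℕ) {{_ : NonZero m}} → Fin m → Fin m → Set
CAdj m a b = (toℕ b ≡ suc (toℕ a) % m) ⊎ (toℕ a ≡ suc (toℕ b) % m)

PowAdj : (m : ℕ) {{_ : NonZero m}} (n : ℕ) → (Fin n → Fin m) → (Fin n → Fin m) → Set
PowAdj m n x y = ∀ i → CAdj m (x i) (y i)

Op : Set → Set → ℕ → Set
Op A B n = (Fin n → A) → B

IsPol : (k : ℕ) {{_ : NonZero k}} {n : ℕ} → Op (Fin k) (Fin 3) n → Set
IsPol k {n} g = ∀ x y → PowAdj k n x y → CAdj 3 (g x) (g y)

minor : {A B : Set} {m n : ℕ} → Op A B m → (Fin m → Fin n) → Op A B n
minor g π = λ x → g (x ∘ π)

minor-pol : (k : ℕ) {{_ : NonZero k}} {m n : ℕ} (g : Op (Fin k) (Fin 3) m)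
            (π : Fin m → Fin n) → IsPol k g → IsPol k (minor g π)
minor-pol k g π p x y e = p (x ∘ π) (y ∘ π) (λ i → e (π i))

Σℕ : (n : ℕ) → (Fin n → ℕ) → ℕ
Σℕ zero    f = 0
Σℕ (suc n) f = f zero + Σℕ n (f ∘ suc)

Σℤ : (n : ℕ) → (Fin n → ℤ) → ℤ
Σℤ zero    f = ℤ.+ 0
Σℤ (suc n) f = f zero ℤ.+ Σℤ n (f ∘ suc)

InZ : (N n : ℕ) → Op ℤ ℤ n → Set
InZ N n f = Σ (Fin n → ℤ) λ c →
  (Σℕ n (λ i → ∣ c i ∣) ≤ N) × (∣ Σℤ n c ∣ % 2 ≡ 1) ×
  (∀ x → f x ≡ Σℤ n (λ i → c i ℤ.* x i))

-- Functions are compared extensionally (pointwise), so ξ is required to respect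
-- pointwise equality of its input (and not depend on the polymorphism proof).
record MinionHom (k : ℕ) {{_ : NonZero k}} (N : ℕ) : Set where
  field
    ξ     : ∀ {n} (g : Op (Fin k) (Fin 3) (suc n)) → IsPol k g → Op ℤ ℤ (suc n)
    ξ-in  : ∀ {n} (g : Op (Fin k) (Fin 3) (suc n)) (p : IsPol k g) → InZ N (suc n) (ξ g p)
    ξ-ext : ∀ {n} (g g′ : Op (Fin k) (Fin 3) (suc n)) (p : IsPol k g) (p′ : IsPol k g′) →
            (∀ x → g x ≡ g′ x) → ∀ x → ξ g p x ≡ ξ g′ p′ x
    ξ-minor : ∀ {m n} (g : Op (Fin k) (Fin 3) (suc m)) (p : IsPol k g)
              (π : Fin (suc m) → Fin (suc n)) →
              ∀ x → ξ (minor g π) (minor-pol k g π p) x ≡ minor (ξ g p) π x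

-- For A ∈ ℤⁿ write 2A for the vertex (2A₁ mod k, …, 2Aₙ mod k) of C_kⁿ. If A, B, C are pointwise
-- within distance 1 of each other, 2A, 2B, 2C have a common (odd) neighbour, so a polymorphism g sends
-- them to a non-rainbow triple of K₃: the signed arcs of g form a cocycle on such triangles. For a
-- direction ε ∈ {−1, 0, 1}ⁿ let w(ε) be the winding number of g along the closed loop t ↦ 2tε, t < k.
-- Integrating the cocycle over planes, two coordinates at a time, gives w(ε) = Σ εᵢ cᵢ with cᵢ = w(eᵢ).
-- The loop runs twice along the closed walk s ↦ sε of odd length k in C_kⁿ, two steps at a time, so
-- w(ε) is odd when no εᵢ is 0; and k arcs wind at most k/3 times. Taking ε to be the sign vector of c gives
-- Σ |cᵢ| odd and at most k/3, hence at most N; ε = (1, …, 1) gives Σ cᵢ odd. The loops of a minor of g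
-- are loops of g in substituted directions, so g ↦ Σ cᵢ xᵢ commutes with minors.

module Submission where

open import Defs
open import Algebra.Bundles using (AbelianGroup)
import Data.Nat as ℕ
open import Data.Nat using (ℕ; zero; suc; NonZero; z≤n; s≤s)
import Data.Nat.Properties as ℕP
import Data.Nat.DivMod as ℕD
open import Data.Integer using (ℤ; +_; -[1+_]; _+_; _*_; -_; _-_; ∣_∣; 0ℤ; 1ℤ; -1ℤ; _%ℕ_; _/ℕ_)
import Data.Integer.Properties as ℤP
import Data.Integer.DivMod as ℤD
open import Data.Integer.Tactic.RingSolver using (solve-∀)
open import Data.Fin using (Fin; toℕ; fromℕ<; punchOut) renaming (zero to fzero; suc to fsuc)
import Data.Fin.Properties as FinP
open import Data.Vec using (lookup; tabulate)
import Data.Vec.Properties as VecP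
open import Data.Vec.Functional using (_∷_)
open import Data.Product using (∃-syntax; _×_; _,_; proj₁; proj₂)
open import Data.Sum using (_⊎_; inj₁; inj₂)
open import Data.Empty using (⊥-elim)
open import Function using (_∘_)
open import Relation.Nullary using (¬_; yes; no)
open import Relation.Binary.PropositionalEquality
open import Algebra.Properties.Group (AbelianGroup.group ℤP.+-0-abelianGroup) using (inverseˡ-unique)

sumRange : ℕ → (ℕ → ℤ) → ℤ
sumRange zero    f = 0ℤ
sumRange (suc n) f = sumRange n f + f n

sumRange-cong : ∀ n {f g : ℕ → ℤ} → (∀ t → f t ≡ g t) → sumRange n f ≡ sumRange n g
sumRange-cong zero    f≗g = refl
sumRange-cong (suc n) f≗g = cong₂ _+_ (sumRange-cong n f≗g) (f≗g n)

sumRange-zero : ∀ n {f : ℕ → ℤ} → (∀ t → f t ≡ 0ℤ) → sumRange n f ≡ 0ℤ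
sumRange-zero zero    f≗0 = refl
sumRange-zero (suc n) f≗0 rewrite sumRange-zero n f≗0 | f≗0 n = refl

sumRange-distrib-+ : ∀ n (f g : ℕ → ℤ) → sumRange n (λ t → f t + g t) ≡ sumRange n f + sumRange n g
sumRange-distrib-+ zero    f g = refl
sumRange-distrib-+ (suc n) f g =
  trans (cong (_+ (f n + g n)) (sumRange-distrib-+ n f g))
        (swap-middle (sumRange n f) (sumRange n g) (f n) (g n))
  where
  swap-middle : ∀ (a b c d : ℤ) → (a + b) + (c + d) ≡ (a + c) + (b + d)
  swap-middle = solve-∀

sumRange-neg : ∀ n (f : ℕ → ℤ) → sumRange n (λ t → - f t) ≡ - sumRange n f
sumRange-neg zero    f = refl
sumRange-neg (suc n) f =
  trans (cong (_+ - f n) (sumRange-neg n f)) (sym (ℤP.neg-distrib-+ (sumRange n f) (f n)))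

*-distribˡ-sumRange : ∀ n (c : ℤ) (f : ℕ → ℤ) → c * sumRange n f ≡ sumRange n (λ t → c * f t)
*-distribˡ-sumRange zero    c f = ℤP.*-zeroʳ c
*-distribˡ-sumRange (suc n) c f =
  trans (ℤP.*-distribˡ-+ c _ _) (cong (_+ c * f n) (*-distribˡ-sumRange n c f))

sumRange-telescope : ∀ n (h : ℕ → ℤ) → sumRange n (λ t → h (suc t) - h t) ≡ h n - h 0
sumRange-telescope zero    h = sym (ℤP.+-inverseʳ (h 0))
sumRange-telescope (suc n) h =
  trans (cong (_+ (h (suc n) - h n)) (sumRange-telescope n h)) (chain (h (suc n)) (h n) (h 0))
  where
  chain : ∀ (a b c : ℤ) → (b - c) + (a - b) ≡ a - c
  chain = solve-∀

sumRange-+ : ∀ m n (f : ℕ → ℤ) → sumRange (m ℕ.+ n) f ≡ sumRange m f + sumRange n (λ t → f (m ℕ.+ t))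
sumRange-+ m zero    f rewrite ℕP.+-identityʳ m = sym (ℤP.+-identityʳ _)
sumRange-+ m (suc n) f rewrite ℕP.+-suc m n =
  trans (cong (_+ f (m ℕ.+ n)) (sumRange-+ m n f))
        (ℤP.+-assoc (sumRange m f) (sumRange n (λ t → f (m ℕ.+ t))) (f (m ℕ.+ n)))

sumRange-pairs : ∀ n (f : ℕ → ℤ) →
                 sumRange n (λ t → f (t ℕ.+ t) + f (suc (t ℕ.+ t))) ≡ sumRange (n ℕ.+ n) f
sumRange-pairs zero    f = refl
sumRange-pairs (suc n) f rewrite ℕP.+-suc n n =
  trans (cong (_+ (f (n ℕ.+ n) + f (suc (n ℕ.+ n)))) (sumRange-pairs n f))
        (sym (ℤP.+-assoc (sumRange (n ℕ.+ n) f) (f (n ℕ.+ n)) (f (suc (n ℕ.+ n)))))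

∣sumRange∣≤ : ∀ n (f : ℕ → ℤ) → (∀ t → ∣ f t ∣ ℕ.≤ 1) → ∣ sumRange n f ∣ ℕ.≤ n
∣sumRange∣≤ zero    f bound = z≤n
∣sumRange∣≤ (suc n) f bound = begin
  ∣ sumRange n f + f n ∣        ≤⟨ ℤP.∣i+j∣≤∣i∣+∣j∣ (sumRange n f) (f n) ⟩
  ∣ sumRange n f ∣ ℕ.+ ∣ f n ∣  ≤⟨ ℕP.+-mono-≤ (∣sumRange∣≤ n f bound) (bound n) ⟩
  n ℕ.+ 1                      ≡⟨ ℕP.+-comm n 1 ⟩
  suc n                        ∎
  where open ℕP.≤-Reasoning

sumRange-±1 : ∀ n (f : ℕ → ℤ) → (∀ t → f t ≡ 1ℤ ⊎ f t ≡ -1ℤ) → ∃[ q ] sumRange n f ≡ + n + + 2 * q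
sumRange-±1 zero    f ±1 = 0ℤ , refl
sumRange-±1 (suc n) f ±1 with sumRange-±1 n f ±1 | ±1 n
... | q , eq | inj₁ fn≡1 rewrite eq | fn≡1 = q , plus-one (+ n) q
  where
  plus-one : ∀ (a q : ℤ) → a + + 2 * q + 1ℤ ≡ (1ℤ + a) + + 2 * q
  plus-one = solve-∀
... | q , eq | inj₂ fn≡-1 rewrite eq | fn≡-1 = q - 1ℤ , minus-one (+ n) q
  where
  minus-one : ∀ (a q : ℤ) → a + + 2 * q + -1ℤ ≡ (1ℤ + a) + + 2 * (q - 1ℤ)
  minus-one = solve-∀

Σℤ-cong : ∀ n {f g : Fin n → ℤ} → (∀ l → f l ≡ g l) → Σℤ n f ≡ Σℤ n g
Σℤ-cong zero    f≗g = refl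
Σℤ-cong (suc n) f≗g = cong₂ _+_ (f≗g fzero) (Σℤ-cong n (f≗g ∘ fsuc))

Σℤ-zero : ∀ n → Σℤ n (λ _ → 0ℤ) ≡ 0ℤ
Σℤ-zero zero    = refl
Σℤ-zero (suc n) = trans (ℤP.+-identityˡ _) (Σℤ-zero n)

Σℤ-distrib-+ : ∀ n (f g : Fin n → ℤ) → Σℤ n (λ l → f l + g l) ≡ Σℤ n f + Σℤ n g
Σℤ-distrib-+ zero    f g = refl
Σℤ-distrib-+ (suc n) f g =
  trans (cong (λ y → f fzero + g fzero + y) (Σℤ-distrib-+ n (f ∘ fsuc) (g ∘ fsuc)))
        (swap-middle (f fzero) (g fzero) (Σℤ n (f ∘ fsuc)) (Σℤ n (g ∘ fsuc)))
  where
  swap-middle : ∀ (a b c d : ℤ) → (a + b) + (c + d) ≡ (a + c) + (b + d)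
  swap-middle = solve-∀

*-distribˡ-Σℤ : ∀ n c (f : Fin n → ℤ) → c * Σℤ n f ≡ Σℤ n (λ l → c * f l)
*-distribˡ-Σℤ zero    c f = ℤP.*-zeroʳ c
*-distribˡ-Σℤ (suc n) c f =
  trans (ℤP.*-distribˡ-+ c (f fzero) (Σℤ n (f ∘ fsuc))) (cong (λ y → c * f fzero + y) (*-distribˡ-Σℤ n c (f ∘ fsuc)))

Σℤ-comm : ∀ m n (f : Fin m → Fin n → ℤ) → Σℤ m (λ i → Σℤ n (f i)) ≡ Σℤ n (λ j → Σℤ m (λ i → f i j))
Σℤ-comm zero    n f = sym (Σℤ-zero n)
Σℤ-comm (suc m) n f =
  trans (cong (λ y → Σℤ n (f fzero) + y) (Σℤ-comm m n (f ∘ fsuc))) (sym (Σℤ-distrib-+ n (f fzero) _))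

Σℤ-pos : ∀ n (f : Fin n → ℕ) → Σℤ n (λ l → + f l) ≡ + Σℕ n f
Σℤ-pos zero    f = refl
Σℤ-pos (suc n) f = cong (λ y → + f fzero + y) (Σℤ-pos n (f ∘ fsuc))

*-distribʳ-Σℤ : ∀ n c (f : Fin n → ℤ) → Σℤ n f * c ≡ Σℤ n (λ l → f l * c)
*-distribʳ-Σℤ zero    c f = refl
*-distribʳ-Σℤ (suc n) c f =
  trans (ℤP.*-distribʳ-+ c (f fzero) (Σℤ n (f ∘ fsuc))) (cong (λ y → f fzero * c + y) (*-distribʳ-Σℤ n c (f ∘ fsuc)))

Σℤ-transpose : ∀ m n (a : Fin m → Fin n → ℤ) (c : Fin m → ℤ) (x : Fin n → ℤ) →
               Σℤ n (λ j → Σℤ m (λ i → a i j * c i) * x j) ≡ Σℤ m (λ i → c i * Σℤ n (λ j → a i j * x j))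
Σℤ-transpose m n a c x = begin
  Σℤ n (λ j → Σℤ m (λ i → a i j * c i) * x j)
    ≡⟨ Σℤ-cong n (λ j → *-distribʳ-Σℤ m (x j) (λ i → a i j * c i)) ⟩
  Σℤ n (λ j → Σℤ m (λ i → a i j * c i * x j))
    ≡⟨ Σℤ-comm m n (λ i j → a i j * c i * x j) ⟨
  Σℤ m (λ i → Σℤ n (λ j → a i j * c i * x j))
    ≡⟨ Σℤ-cong m (λ i → Σℤ-cong n (λ j → rearrange (a i j) (c i) (x j))) ⟩
  Σℤ m (λ i → Σℤ n (λ j → c i * (a i j * x j)))
    ≡⟨ Σℤ-cong m (λ i → *-distribˡ-Σℤ n (c i) (λ j → a i j * x j)) ⟨
  Σℤ m (λ i → c i * Σℤ n (λ j → a i j * x j))   ∎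
  where
  open ≡-Reasoning
  rearrange : ∀ a c x → a * c * x ≡ c * (a * x)
  rearrange = solve-∀

Odd : ℤ → Set
Odd z = ∃[ q ] z ≡ 1ℤ + + 2 * q

odd-∣_∣ : ∀ {z} → Odd z → ∣ z ∣ ℕ.% 2 ≡ 1
odd-∣_∣ (+ m , refl) = begin
  ∣ 1ℤ + + 2 * + m ∣ ℕ.% 2  ≡⟨ cong (λ z → ∣ 1ℤ + z ∣ ℕ.% 2) (ℤP.pos-* 2 m) ⟨
  (1 ℕ.+ 2 ℕ.* m) ℕ.% 2     ≡⟨ cong (λ y → (1 ℕ.+ y) ℕ.% 2) (ℕP.*-comm 2 m) ⟩
  (1 ℕ.+ m ℕ.* 2) ℕ.% 2     ≡⟨ ℕD.[m+kn]%n≡m%n 1 m 2 ⟩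
  1                         ∎
  where open ≡-Reasoning
odd-∣_∣ (-[1+ m ] , refl) = begin
  ∣ 1ℤ + + 2 * -[1+ m ] ∣ ℕ.% 2     ≡⟨ cong (λ z → ∣ z ∣ ℕ.% 2) (reflect (+ m)) ⟩
  ∣ - (1ℤ + + 2 * + m) ∣ ℕ.% 2      ≡⟨ cong (ℕ._% 2) (ℤP.∣-i∣≡∣i∣ (1ℤ + + 2 * + m)) ⟩
  ∣ 1ℤ + + 2 * + m ∣ ℕ.% 2          ≡⟨ odd-∣ + m , refl ∣ ⟩
  1                                 ∎
  where
  open ≡-Reasoning
  reflect : ∀ M → 1ℤ + + 2 * (- (1ℤ + M)) ≡ - (1ℤ + + 2 * M)
  reflect = solve-∀

odd-neg : ∀ {z} → Odd z → Odd (- z)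
odd-neg (q , refl) = -1ℤ - q , reflect q
  where
  reflect : ∀ q → - (1ℤ + + 2 * q) ≡ 1ℤ + + 2 * (-1ℤ - q)
  reflect = solve-∀

odd-3* : ∀ x → Odd (+ 3 * x) → Odd x
odd-3* x (q , 3x≡1+2q) = q - x , (begin
  x                          ≡⟨ thrice-minus-twice x ⟩
  + 3 * x - + 2 * x          ≡⟨ cong (_- + 2 * x) 3x≡1+2q ⟩
  1ℤ + + 2 * q - + 2 * x     ≡⟨ collect q x ⟩
  1ℤ + + 2 * (q - x)         ∎)
  where
  open ≡-Reasoning
  thrice-minus-twice : ∀ x → x ≡ + 3 * x - + 2 * x
  thrice-minus-twice = solve-∀
  collect : ∀ q x → 1ℤ + + 2 * q - + 2 * x ≡ 1ℤ + + 2 * (q - x)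
  collect = solve-∀

odd-sumRange-±1 : ∀ n (f : ℕ → ℤ) → n ℕ.% 2 ≡ 1 → (∀ t → f t ≡ 1ℤ ⊎ f t ≡ -1ℤ) → Odd (sumRange n f)
odd-sumRange-±1 n f n-odd ±1 with sumRange-±1 n f ±1
... | q , Σ≡n+2q = + (n ℕ./ 2) + q , (begin
  sumRange n f                      ≡⟨ Σ≡n+2q ⟩
  + n + + 2 * q                     ≡⟨ cong (λ m → + m + + 2 * q) n≡1+2h ⟩
  + (1 ℕ.+ n ℕ./ 2 ℕ.* 2) + + 2 * q ≡⟨ cong (λ z → 1ℤ + z + + 2 * q) (ℤP.pos-* (n ℕ./ 2) 2) ⟩
  1ℤ + + (n ℕ./ 2) * + 2 + + 2 * q  ≡⟨ collect (+ (n ℕ./ 2)) q ⟩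
  1ℤ + + 2 * (+ (n ℕ./ 2) + q)      ∎)
  where
  open ≡-Reasoning
  n≡1+2h : n ≡ 1 ℕ.+ n ℕ./ 2 ℕ.* 2
  n≡1+2h = trans (ℕD.m≡m%n+[m/n]*n n 2) (cong (ℕ._+ n ℕ./ 2 ℕ.* 2) n-odd)
  collect : ∀ h q → 1ℤ + h * + 2 + + 2 * q ≡ 1ℤ + + 2 * (h + q)
  collect = solve-∀

odd-≤ : ∀ {s N} → s ℕ.% 2 ≡ 1 → N ℕ.% 2 ≡ 1 → s ℕ.< N ℕ.+ 2 → s ℕ.≤ N
odd-≤ {s} {N} s-odd N-odd s<N+2 with ℕP.m<1+n⇒m<n∨m≡n (subst (s ℕ.<_) (ℕP.+-comm N 2) s<N+2)
... | inj₁ s<N+1 = ℕP.≤-pred s<N+1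
... | inj₂ refl = ⊥-elim (1≢0 (begin
  1                        ≡⟨ s-odd ⟨
  (1 ℕ.+ N) ℕ.% 2          ≡⟨ ℕD.%-distribˡ-+ 1 N 2 ⟩
  (1 ℕ.+ N ℕ.% 2) ℕ.% 2    ≡⟨ cong (λ r → (1 ℕ.+ r) ℕ.% 2) N-odd ⟩
  0                        ∎))
  where
  open ≡-Reasoning
  1≢0 : 1 ≢ 0
  1≢0 ()

pattern 0₃ = fzero
pattern 1₃ = fsuc fzero
pattern 2₃ = fsuc (fsuc fzero)

-- Around a closed walk in K₃ the arcs add up to three times its winding number.
arc : Fin 3 → Fin 3 → ℤ
arc 0₃ 0₃ = 0ℤ
arc 0₃ 1₃ = -1ℤ
arc 0₃ 2₃ = 1ℤ
arc 1₃ 0₃ = 1ℤ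
arc 1₃ 1₃ = 0ℤ
arc 1₃ 2₃ = -1ℤ
arc 2₃ 0₃ = -1ℤ
arc 2₃ 1₃ = 1ℤ
arc 2₃ 2₃ = 0ℤ

wrap : Fin 3 → Fin 3 → ℤ
wrap 0₃ 2₃ = 1ℤ
wrap 2₃ 0₃ = -1ℤ
wrap _  _  = 0ℤ

arc≡difference+3wrap : ∀ a b → arc a b ≡ + toℕ a - + toℕ b + + 3 * wrap a b
arc≡difference+3wrap 0₃ 0₃ = refl
arc≡difference+3wrap 0₃ 1₃ = refl
arc≡difference+3wrap 0₃ 2₃ = refl
arc≡difference+3wrap 1₃ 0₃ = refl
arc≡difference+3wrap 1₃ 1₃ = refl
arc≡difference+3wrap 1₃ 2₃ = refl
arc≡difference+3wrap 2₃ 0₃ = refl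
arc≡difference+3wrap 2₃ 1₃ = refl
arc≡difference+3wrap 2₃ 2₃ = refl

arc-diag : ∀ a → arc a a ≡ 0ℤ
arc-diag 0₃ = refl
arc-diag 1₃ = refl
arc-diag 2₃ = refl

arc-anti : ∀ a b → arc b a ≡ - arc a b
arc-anti 0₃ 0₃ = refl
arc-anti 0₃ 1₃ = refl
arc-anti 0₃ 2₃ = refl
arc-anti 1₃ 0₃ = refl
arc-anti 1₃ 1₃ = refl
arc-anti 1₃ 2₃ = refl
arc-anti 2₃ 0₃ = refl
arc-anti 2₃ 1₃ = refl
arc-anti 2₃ 2₃ = refl

∣arc∣≤1 : ∀ a b → ∣ arc a b ∣ ℕ.≤ 1
∣arc∣≤1 0₃ 0₃ = z≤n
∣arc∣≤1 0₃ 1₃ = s≤s z≤n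
∣arc∣≤1 0₃ 2₃ = s≤s z≤n
∣arc∣≤1 1₃ 0₃ = s≤s z≤n
∣arc∣≤1 1₃ 1₃ = z≤n
∣arc∣≤1 1₃ 2₃ = s≤s z≤n
∣arc∣≤1 2₃ 0₃ = s≤s z≤n
∣arc∣≤1 2₃ 1₃ = s≤s z≤n
∣arc∣≤1 2₃ 2₃ = z≤n

arc-±1 : ∀ {a b} → a ≢ b → arc a b ≡ 1ℤ ⊎ arc a b ≡ -1ℤ
arc-±1 {0₃} {0₃} a≢b = ⊥-elim (a≢b refl)
arc-±1 {0₃} {1₃} _   = inj₂ refl
arc-±1 {0₃} {2₃} _   = inj₁ refl
arc-±1 {1₃} {0₃} _   = inj₁ refl
arc-±1 {1₃} {1₃} a≢b = ⊥-elim (a≢b refl)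
arc-±1 {1₃} {2₃} _   = inj₂ refl
arc-±1 {2₃} {0₃} _   = inj₂ refl
arc-±1 {2₃} {1₃} _   = inj₁ refl
arc-±1 {2₃} {2₃} a≢b = ⊥-elim (a≢b refl)

arc-rotate : ∀ {a b c} → a ≢ b → b ≢ c → a ≢ c → arc a b ≡ arc b c
arc-rotate {0₃} {1₃} {2₃} _ _ _ = refl
arc-rotate {0₃} {2₃} {1₃} _ _ _ = refl
arc-rotate {1₃} {0₃} {2₃} _ _ _ = refl
arc-rotate {1₃} {2₃} {0₃} _ _ _ = refl
arc-rotate {2₃} {0₃} {1₃} _ _ _ = refl
arc-rotate {2₃} {1₃} {0₃} _ _ _ = refl
arc-rotate {0₃} {0₃} a≢b _ _ = ⊥-elim (a≢b refl)
arc-rotate {1₃} {1₃} a≢b _ _ = ⊥-elim (a≢b refl)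
arc-rotate {2₃} {2₃} a≢b _ _ = ⊥-elim (a≢b refl)
arc-rotate {_} {0₃} {0₃} _ b≢c _ = ⊥-elim (b≢c refl)
arc-rotate {_} {1₃} {1₃} _ b≢c _ = ⊥-elim (b≢c refl)
arc-rotate {_} {2₃} {2₃} _ b≢c _ = ⊥-elim (b≢c refl)
arc-rotate {0₃} {_} {0₃} _ _ a≢c = ⊥-elim (a≢c refl)
arc-rotate {1₃} {_} {1₃} _ _ a≢c = ⊥-elim (a≢c refl)
arc-rotate {2₃} {_} {2₃} _ _ a≢c = ⊥-elim (a≢c refl)

arc-cocycle-degenerate : ∀ {a b c} → a ≡ b ⊎ b ≡ c ⊎ a ≡ c → arc a b + arc b c ≡ arc a c
arc-cocycle-degenerate {a} {_} {c} (inj₁ refl) =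
  trans (cong (_+ arc a c) (arc-diag a)) (ℤP.+-identityˡ (arc a c))
arc-cocycle-degenerate {a} {b} {_} (inj₂ (inj₁ refl)) =
  trans (cong (λ x → arc a b + x) (arc-diag b)) (ℤP.+-identityʳ (arc a b))
arc-cocycle-degenerate {a} {b} {_} (inj₂ (inj₂ refl)) =
  trans (cong (λ x → arc a b + x) (arc-anti a b)) (trans (ℤP.+-inverseʳ (arc a b)) (sym (arc-diag a)))

K₃-irreflexive : ∀ a → ¬ CAdj 3 a a
K₃-irreflexive 0₃ (inj₁ ())
K₃-irreflexive 0₃ (inj₂ ())
K₃-irreflexive 1₃ (inj₁ ())
K₃-irreflexive 1₃ (inj₂ ())
K₃-irreflexive 2₃ (inj₁ ())
K₃-irreflexive 2₃ (inj₂ ())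

K₃-adjacent⇒≢ : ∀ {a b} → CAdj 3 a b → a ≢ b
K₃-adjacent⇒≢ {a} adj refl = K₃-irreflexive a adj

-- Pigeonhole: K₃ minus a vertex has only two elements.
avoiding-collide : ∀ {a b c z : Fin 3} → z ≢ a → z ≢ b → z ≢ c → a ≡ b ⊎ b ≡ c ⊎ a ≡ c
avoiding-collide {a} {b} {c} {z} z≢a z≢b z≢c = collision (FinP.pigeonhole (ℕP.n<1+n 2) punchOut-z)
  where
  punchOut-z : Fin 3 → Fin 2
  punchOut-z 0₃ = punchOut z≢a
  punchOut-z 1₃ = punchOut z≢b
  punchOut-z 2₃ = punchOut z≢c
  collision : ∃[ i ] ∃[ j ] (i Data.Fin.< j × punchOut-z i ≡ punchOut-z j) → a ≡ b ⊎ b ≡ c ⊎ a ≡ c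
  collision (0₃ , 1₃ , _ , eq) = inj₁ (FinP.punchOut-injective z≢a z≢b eq)
  collision (0₃ , 2₃ , _ , eq) = inj₂ (inj₂ (FinP.punchOut-injective z≢a z≢c eq))
  collision (1₃ , 2₃ , _ , eq) = inj₂ (inj₁ (FinP.punchOut-injective z≢b z≢c eq))
  collision (0₃ , 0₃ , () , _)
  collision (1₃ , 0₃ , () , _)
  collision (1₃ , 1₃ , s≤s () , _)
  collision (2₃ , 0₃ , () , _)
  collision (2₃ , 1₃ , s≤s () , _)
  collision (2₃ , 2₃ , s≤s (s≤s ()) , _)

arc-cocycle : ∀ {a b c z} → CAdj 3 a z → CAdj 3 b z → CAdj 3 c z → arc a b + arc b c ≡ arc a c
arc-cocycle az bz cz = arc-cocycle-degenerate
  (avoiding-collide (≢-sym (K₃-adjacent⇒≢ az)) (≢-sym (K₃-adjacent⇒≢ bz)) (≢-sym (K₃-adjacent⇒≢ cz)))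

arc-double : ∀ {a b c} → CAdj 3 a b → CAdj 3 b c → + 2 * arc a c ≡ - (arc a b + arc b c)
arc-double {a} {b} {c} ab bc with a FinP.≟ c
... | yes refl = begin
  + 2 * arc a a           ≡⟨ cong (+ 2 *_) (arc-diag a) ⟩
  0ℤ                      ≡⟨ there-and-back (arc a b) ⟩
  - (arc a b + - arc a b) ≡⟨ cong (λ x → - (arc a b + x)) (arc-anti a b) ⟨
  - (arc a b + arc b a)   ∎
  where
  open ≡-Reasoning
  there-and-back : ∀ x → 0ℤ ≡ - (x + - x)
  there-and-back = solve-∀
... | no a≢c = begin
  + 2 * arc a c             ≡⟨ twice (arc a c) ⟩
  - (- arc a c + - arc a c) ≡⟨ cong (λ x → - (x + x)) (trans rotate-ab (trans rotate-bc (arc-anti a c))) ⟨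
  - (arc a b + arc a b)     ≡⟨ cong (λ x → - (arc a b + x)) rotate-ab ⟩
  - (arc a b + arc b c)     ∎
  where
  open ≡-Reasoning
  rotate-ab : arc a b ≡ arc b c
  rotate-ab = arc-rotate (K₃-adjacent⇒≢ ab) (K₃-adjacent⇒≢ bc) a≢c
  rotate-bc : arc b c ≡ arc c a
  rotate-bc = arc-rotate (K₃-adjacent⇒≢ bc) (a≢c ∘ sym) (K₃-adjacent⇒≢ ab ∘ sym)
  twice : ∀ x → + 2 * x ≡ - (- x + - x)
  twice = solve-∀

closedSum : ℕ → (Fin 3 → Fin 3 → ℤ) → (ℕ → Fin 3) → ℤ
closedSum n f a = sumRange n (λ t → f (a t) (a (suc t))) + f (a n) (a 0)

closedSum-cong : ∀ n f {a b : ℕ → Fin 3} → (∀ t → a t ≡ b t) → closedSum n f a ≡ closedSum n f b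
closedSum-cong n f a≗b = cong₂ _+_ (sumRange-cong n (λ t → cong₂ f (a≗b t) (a≗b (suc t)))) (cong₂ f (a≗b n) (a≗b 0))

closedSum-arc : ∀ n a → closedSum n arc a ≡ + 3 * closedSum n wrap a
closedSum-arc n a = begin
  closedSum n arc a
    ≡⟨ cong₂ _+_ (sumRange-cong n (λ t → trans (arc≡difference+3wrap (a t) (a (suc t)))
                                               (as-increment (τ t) (τ (suc t)) (w t))))
                 (arc≡difference+3wrap (a n) (a 0)) ⟩
  sumRange n (λ t → (- τ (suc t) - - τ t) + + 3 * w t) + (τ n - τ 0 + + 3 * w′)
    ≡⟨ cong (_+ (τ n - τ 0 + + 3 * w′)) (sumRange-distrib-+ n (λ t → - τ (suc t) - - τ t) (λ t → + 3 * w t)) ⟩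
  (sumRange n (λ t → - τ (suc t) - - τ t) + sumRange n (λ t → + 3 * w t)) + (τ n - τ 0 + + 3 * w′)
    ≡⟨ cong₂ (λ x y → (x + y) + (τ n - τ 0 + + 3 * w′))
             (sumRange-telescope n (λ t → - τ t)) (sym (*-distribˡ-sumRange n (+ 3) w)) ⟩
  ((- τ n - - τ 0) + + 3 * sumRange n w) + (τ n - τ 0 + + 3 * w′)
    ≡⟨ cancel (τ n) (τ 0) (sumRange n w) w′ ⟩
  + 3 * closedSum n wrap a ∎
  where
  open ≡-Reasoning
  τ : ℕ → ℤ
  τ t = + toℕ (a t)
  w : ℕ → ℤ
  w t = wrap (a t) (a (suc t))
  w′ : ℤ
  w′ = wrap (a n) (a 0)
  as-increment : ∀ x y c → x - y + + 3 * c ≡ (- y - - x) + + 3 * c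
  as-increment = solve-∀
  cancel : ∀ x y S c → ((- x - - y) + + 3 * S) + (x - y + + 3 * c) ≡ + 3 * (S + c)
  cancel = solve-∀

∣closedSum-arc∣≤ : ∀ n a → ∣ closedSum n arc a ∣ ℕ.≤ suc n
∣closedSum-arc∣≤ n a = begin
  ∣ closedSum n arc a ∣
    ≤⟨ ℤP.∣i+j∣≤∣i∣+∣j∣ (sumRange n steps) (arc (a n) (a 0)) ⟩
  ∣ sumRange n steps ∣ ℕ.+ ∣ arc (a n) (a 0) ∣
    ≤⟨ ℕP.+-mono-≤ (∣sumRange∣≤ n steps (λ t → ∣arc∣≤1 (a t) (a (suc t)))) (∣arc∣≤1 (a n) (a 0)) ⟩
  n ℕ.+ 1
    ≡⟨ ℕP.+-comm n 1 ⟩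
  suc n ∎
  where
  open ℕP.≤-Reasoning
  steps : ℕ → ℤ
  steps t = arc (a t) (a (suc t))

CAdj-sym : ∀ {m} {{_ : NonZero m}} {a b : Fin m} → CAdj m a b → CAdj m b a
CAdj-sym (inj₁ b≡a+1) = inj₂ b≡a+1
CAdj-sym (inj₂ a≡b+1) = inj₁ a≡b+1

module Cover (k : ℕ) {{_ : NonZero k}} where

  remainder-unique : ∀ {r r′} (d : ℤ) → r ℕ.< k → r′ ℕ.< k → + r′ ≡ + r + d * + k → r′ ≡ r
  remainder-unique {r} (+ zero) _ _ eq = trans (ℤP.+-injective eq) (ℕP.+-identityʳ r)
  remainder-unique {r} {r′} (+ suc m) _ r′<k eq = ⊥-elim (ℕP.<⇒≱ r′<k (begin
    k                      ≤⟨ ℕP.m≤m+n k (m ℕ.* k) ⟩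
    suc m ℕ.* k            ≤⟨ ℕP.m≤n+m (suc m ℕ.* k) r ⟩
    r ℕ.+ suc m ℕ.* k      ≡⟨ ℤP.+-injective (trans (cong (λ z → + r + z) (ℤP.pos-* (suc m) k)) (sym eq)) ⟩
    r′                     ∎))
    where open ℕP.≤-Reasoning
  remainder-unique {r} {r′} -[1+ m ] r<k r′<k eq =
    sym (remainder-unique (+ suc m) r′<k r<k (move {d = -[1+ m ]} {c = + k} eq))
    where
    move : ∀ {a b d c : ℤ} → a ≡ b + d * c → b ≡ a + (- d) * c
    move {b = b} {d} {c} refl = shift b d c
      where
      shift : ∀ b d c → b ≡ b + d * c + (- d) * c
      shift = solve-∀

  %ℕ-unique : ∀ x {r} (q : ℤ) → r ℕ.< k → x ≡ + r + q * + k → x %ℕ k ≡ r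
  %ℕ-unique x {r} q r<k x≡r+qk = remainder-unique (q - x /ℕ k) r<k (ℤD.n%ℕd<d x k) (begin
    + (x %ℕ k)                                ≡⟨ add-sub (+ (x %ℕ k)) (x /ℕ k * + k) ⟩
    + (x %ℕ k) + x /ℕ k * + k - x /ℕ k * + k  ≡⟨ cong (_- x /ℕ k * + k) (ℤD.a≡a%ℕn+[a/ℕn]*n x k) ⟨
    x - x /ℕ k * + k                          ≡⟨ cong (_- x /ℕ k * + k) x≡r+qk ⟩
    + r + q * + k - x /ℕ k * + k              ≡⟨ collect (+ r) q (x /ℕ k) (+ k) ⟩
    + r + (q - x /ℕ k) * + k                  ∎)
    where
    open ≡-Reasoning
    add-sub : ∀ a b → a ≡ a + b - b
    add-sub = solve-∀
    collect : ∀ a q p c → a + q * c - p * c ≡ a + (q - p) * c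
    collect = solve-∀

  cover : ℤ → Fin k
  cover x = fromℕ< (ℤD.n%ℕd<d x k)

  toℕ-cover : ∀ x → toℕ (cover x) ≡ x %ℕ k
  toℕ-cover x = FinP.toℕ-fromℕ< (ℤD.n%ℕd<d x k)

  cover-periodic : ∀ x q → cover (x + q * + k) ≡ cover x
  cover-periodic x q = FinP.toℕ-injective (begin
    toℕ (cover (x + q * + k))  ≡⟨ toℕ-cover (x + q * + k) ⟩
    (x + q * + k) %ℕ k         ≡⟨ %ℕ-unique (x + q * + k) (x /ℕ k + q) (ℤD.n%ℕd<d x k) x+qk≡r+[q₀+q]k ⟩
    x %ℕ k                     ≡⟨ toℕ-cover x ⟨
    toℕ (cover x)              ∎)
    where
    open ≡-Reasoning
    collect : ∀ a b q c → a + b * c + q * c ≡ a + (b + q) * c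
    collect = solve-∀
    x+qk≡r+[q₀+q]k : x + q * + k ≡ + (x %ℕ k) + (x /ℕ k + q) * + k
    x+qk≡r+[q₀+q]k = trans (cong (_+ q * + k) (ℤD.a≡a%ℕn+[a/ℕn]*n x k)) (collect (+ (x %ℕ k)) (x /ℕ k) q (+ k))

  cover-adjacent : ∀ x → CAdj k (cover x) (cover (x + 1ℤ))
  cover-adjacent x = inj₁ (begin
    toℕ (cover (x + 1ℤ))  ≡⟨ toℕ-cover (x + 1ℤ) ⟩
    (x + 1ℤ) %ℕ k         ≡⟨ successor (ℕP.m≤n⇒m<n∨m≡n (ℤD.n%ℕd<d x k)) ⟩
    suc r ℕ.% k           ≡⟨ cong (λ z → suc z ℕ.% k) (toℕ-cover x) ⟨
    suc (toℕ (cover x)) ℕ.% k ∎)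
    where
    open ≡-Reasoning
    r : ℕ
    r = x %ℕ k
    q : ℤ
    q = x /ℕ k
    x+1≡ : x + 1ℤ ≡ + suc r + q * + k
    x+1≡ = trans (cong (_+ 1ℤ) (ℤD.a≡a%ℕn+[a/ℕn]*n x k)) (shuffle (+ r) q (+ k))
      where
      shuffle : ∀ a b c → a + b * c + 1ℤ ≡ (1ℤ + a) + b * c
      shuffle = solve-∀
    successor : suc r ℕ.< k ⊎ suc r ≡ k → (x + 1ℤ) %ℕ k ≡ suc r ℕ.% k
    successor (inj₁ r+1<k) = trans (%ℕ-unique (x + 1ℤ) q r+1<k x+1≡) (sym (ℕD.m<n⇒m%n≡m r+1<k))
    successor (inj₂ r+1≡k) = begin
      (x + 1ℤ) %ℕ k  ≡⟨ %ℕ-unique (x + 1ℤ) (q + 1ℤ) (ℕ.>-nonZero⁻¹ k) x+1≡[q+1]k ⟩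
      0              ≡⟨ ℕD.n%n≡0 k ⟨
      k ℕ.% k        ≡⟨ cong (ℕ._% k) r+1≡k ⟨
      suc r ℕ.% k    ∎
      where
      carry : ∀ b c → c + b * c ≡ + 0 + (b + 1ℤ) * c
      carry = solve-∀
      x+1≡[q+1]k : x + 1ℤ ≡ + 0 + (q + 1ℤ) * + k
      x+1≡[q+1]k = trans x+1≡ (trans (cong (λ z → + z + q * + k) r+1≡k) (carry q (+ k)))

data Trit : Set where
  pos nul neg : Trit

⟦_⟧ : Trit → ℤ
⟦ pos ⟧ = 1ℤ
⟦ nul ⟧ = 0ℤ
⟦ neg ⟧ = -1ℤ

unit : ∀ {n} → Fin n → Fin n → Trit
unit fzero    fzero    = pos
unit fzero    (fsuc _) = nul
unit (fsuc j) fzero    = nul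
unit (fsuc j) (fsuc l) = unit j l

Σℤ-unit : ∀ n (x : Fin n → ℤ) l → Σℤ n (λ j → ⟦ unit j l ⟧ * x j) ≡ x l
Σℤ-unit (suc n) x fzero = begin
  1ℤ * x fzero + Σℤ n (λ j → 0ℤ * x (fsuc j)) ≡⟨ cong₂ _+_ (ℤP.*-identityˡ (x fzero)) (Σℤ-zero n) ⟩
  x fzero + 0ℤ                               ≡⟨ ℤP.+-identityʳ (x fzero) ⟩
  x fzero                                    ∎
  where open ≡-Reasoning
Σℤ-unit (suc n) x (fsuc l) = trans (ℤP.+-identityˡ _) (Σℤ-unit n (x ∘ fsuc) l)

Near : ℤ → ℤ → Set
Near x y = y ≡ x ⊎ y ≡ x + 1ℤ ⊎ x ≡ y + 1ℤ

near-refl : ∀ x → Near x x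
near-refl x = inj₁ refl

near-suc : ∀ x → Near x (x + 1ℤ)
near-suc x = inj₂ (inj₁ refl)

near-step : ∀ x s → Near x (x + ⟦ s ⟧)
near-step x pos = near-suc x
near-step x nul = inj₁ (ℤP.+-identityʳ x)
near-step x neg = inj₂ (inj₂ (back x))
  where
  back : ∀ x → x ≡ x + -1ℤ + 1ℤ
  back = solve-∀

near-scale : ∀ s {x y} → Near x y → Near (⟦ s ⟧ * x) (⟦ s ⟧ * y)
near-scale pos {x} {y} near rewrite ℤP.*-identityˡ x | ℤP.*-identityˡ y = near
near-scale nul near = inj₁ refl
near-scale neg {x} {y} near rewrite ℤP.-1*i≡-i x | ℤP.-1*i≡-i y = negate near
  where
  neg-suc : ∀ x → - x ≡ - (x + 1ℤ) + 1ℤ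
  neg-suc = solve-∀
  negate : ∀ {x y} → Near x y → Near (- x) (- y)
  negate (inj₁ refl) = inj₁ refl
  negate {x} (inj₂ (inj₁ refl)) = inj₂ (inj₂ (neg-suc x))
  negate {y = y} (inj₂ (inj₂ refl)) = inj₂ (inj₁ (neg-suc y))

Corner : ℤ → ℤ → ℤ → Set
Corner x y z = Near x z × (y ≡ x ⊎ y ≡ z)

InWindow : ℤ → ℤ → Set
InWindow m x = x ≡ m ⊎ x ≡ m + 1ℤ

near-window : ∀ {x z} → Near x z → ∃[ m ] InWindow m x × InWindow m z
near-window {x} (inj₁ z≡x)          = x , inj₁ refl , inj₁ z≡x
near-window {x} (inj₂ (inj₁ z≡x+1)) = x , inj₁ refl , inj₂ z≡x+1
near-window {z = z} (inj₂ (inj₂ x≡z+1)) = z , inj₂ x≡z+1 , inj₁ refl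

corner-window : ∀ {x y z} → Corner x y z → ∃[ m ] InWindow m x × InWindow m y × InWindow m z
corner-window (near , inj₁ refl) with near-window near
... | m , x∈m , z∈m = m , x∈m , x∈m , z∈m
corner-window (near , inj₂ refl) with near-window near
... | m , x∈m , z∈m = m , x∈m , z∈m , z∈m

corner-first : ∀ {x z} → Near x z → Corner x x z
corner-first near = near , inj₁ refl

corner-last : ∀ {x z} → Near x z → Corner x z z
corner-last near = near , inj₂ refl

corner-scale : ∀ s {x y z} → Corner x y z → Corner (⟦ s ⟧ * x) (⟦ s ⟧ * y) (⟦ s ⟧ * z)
corner-scale s (near , inj₁ refl) = near-scale s near , inj₁ refl
corner-scale s (near , inj₂ refl) = near-scale s near , inj₂ refl

constant-on-ℤ : ∀ (h : ℤ → ℤ) → (∀ m → h (m + 1ℤ) ≡ h m) → ∀ m → h m ≡ h 0ℤ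
constant-on-ℤ h step (+ zero)    = refl
constant-on-ℤ h step (+ suc n)   =
  trans (cong (h ∘ +_) (ℕP.+-comm 1 n)) (trans (step (+ n)) (constant-on-ℤ h step (+ n)))
constant-on-ℤ h step -[1+ zero ]  = sym (step -[1+ zero ])
constant-on-ℤ h step -[1+ suc n ] = trans (sym (step -[1+ suc n ])) (constant-on-ℤ h step -[1+ n ])

-- ∫ f m = Σ_{0 ≤ u < m} f u, read as − Σ_{m ≤ u < 0} f u when m < 0.
∫ : (ℤ → ℤ) → ℤ → ℤ
∫ f (+ n)    = sumRange n (f ∘ +_)
∫ f -[1+ n ] = - sumRange (suc n) (λ u → f -[1+ u ])

∫-step : ∀ f m → ∫ f (m + 1ℤ) ≡ ∫ f m + f m
∫-step f (+ n)          = cong (λ j → sumRange j (f ∘ +_)) (ℕP.+-comm n 1)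
∫-step f -[1+ zero ]    = cancel (f -[1+ 0 ])
  where
  cancel : ∀ x → 0ℤ ≡ - (0ℤ + x) + x
  cancel = solve-∀
∫-step f -[1+ suc n ]   = cancel (sumRange (suc n) (λ u → f -[1+ u ])) (f -[1+ suc n ])
  where
  cancel : ∀ S x → - S ≡ - (S + x) + x
  cancel = solve-∀

∫-cong : ∀ {f g : ℤ → ℤ} → (∀ u → f u ≡ g u) → ∀ m → ∫ f m ≡ ∫ g m
∫-cong f≗g (+ n)    = sumRange-cong n (f≗g ∘ +_)
∫-cong f≗g -[1+ n ] = cong -_ (sumRange-cong (suc n) (λ u → f≗g -[1+ u ]))

module _ (P : ℤ) {f : ℤ → ℤ} (periodic : ∀ u → f (u + P) ≡ f u) where

  ∫-shift : ∀ m → ∫ f (m + P) ≡ ∫ f m + ∫ f P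
  ∫-shift m = begin
    ∫ f (m + P)                     ≡⟨ add-sub (∫ f (m + P)) (∫ f m) ⟩
    ∫ f m + (∫ f (m + P) - ∫ f m)   ≡⟨ cong (λ y → ∫ f m + y) (constant-on-ℤ defect defect-step m) ⟩
    ∫ f m + (∫ f (0ℤ + P) - 0ℤ)     ≡⟨ cong (λ y → ∫ f m + (∫ f y - 0ℤ)) (ℤP.+-identityˡ P) ⟩
    ∫ f m + (∫ f P - 0ℤ)            ≡⟨ cong (λ y → ∫ f m + y) (ℤP.+-identityʳ (∫ f P)) ⟩
    ∫ f m + ∫ f P                   ∎
    where
    open ≡-Reasoning
    add-sub : ∀ a b → a ≡ b + (a - b)
    add-sub = solve-∀
    defect : ℤ → ℤ
    defect m = ∫ f (m + P) - ∫ f m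
    same-increment : ∀ a b x → (a + x) - (b + x) ≡ a - b
    same-increment = solve-∀
    defect-step : ∀ m → defect (m + 1ℤ) ≡ defect m
    defect-step m = begin
      ∫ f (m + 1ℤ + P) - ∫ f (m + 1ℤ)           ≡⟨ cong (λ y → ∫ f y - ∫ f (m + 1ℤ)) (swap m P) ⟩
      ∫ f (m + P + 1ℤ) - ∫ f (m + 1ℤ)           ≡⟨ cong₂ _-_ (∫-step f (m + P)) (∫-step f m) ⟩
      (∫ f (m + P) + f (m + P)) - (∫ f m + f m) ≡⟨ cong (λ y → (∫ f (m + P) + y) - (∫ f m + f m)) (periodic m) ⟩
      (∫ f (m + P) + f m) - (∫ f m + f m)       ≡⟨ same-increment (∫ f (m + P)) (∫ f m) (f m) ⟩
      defect m                                  ∎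
      where
      swap : ∀ m p → m + 1ℤ + p ≡ m + p + 1ℤ
      swap = solve-∀

  ∫-scale : ∀ s → ∫ f (P * ⟦ s ⟧) ≡ ⟦ s ⟧ * ∫ f P
  ∫-scale pos = trans (cong (∫ f) (ℤP.*-identityʳ P)) (sym (ℤP.*-identityˡ (∫ f P)))
  ∫-scale nul = cong (∫ f) (ℤP.*-zeroʳ P)
  ∫-scale neg = begin
    ∫ f (P * -1ℤ)   ≡⟨ cong (∫ f) (trans (ℤP.*-comm P -1ℤ) (ℤP.-1*i≡-i P)) ⟩
    ∫ f (- P)       ≡⟨ inverseˡ-unique (∫ f (- P)) (∫ f P) (begin
      ∫ f (- P) + ∫ f P ≡⟨ ∫-shift (- P) ⟨
      ∫ f (- P + P)     ≡⟨ cong (∫ f) (ℤP.+-inverseˡ P) ⟩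
      0ℤ                ∎) ⟩
    - ∫ f P         ≡⟨ ℤP.-1*i≡-i (∫ f P) ⟨
    -1ℤ * ∫ f P     ∎
    where open ≡-Reasoning

difference : ∀ {a b d : ℤ} → a ≡ b + d → d ≡ a - b
difference {b = b} {d} refl = add-sub b d
  where
  add-sub : ∀ b d → d ≡ b + d - b
  add-sub = solve-∀

trit-step : ∀ (φ : ℤ → ℤ) (δ : ℤ → ℤ → ℤ) → (∀ x → δ x x ≡ 0ℤ) → (∀ x y → δ y x ≡ - δ x y) →
            (∀ x → δ x (x + 1ℤ) ≡ φ (x + 1ℤ) - φ x) → ∀ x s → δ x (x + ⟦ s ⟧) ≡ φ (x + ⟦ s ⟧) - φ x
trit-step φ δ diag anti forward x pos = forward x
trit-step φ δ diag anti forward x nul rewrite ℤP.+-identityʳ x = trans (diag x) (sym (ℤP.+-inverseʳ (φ x)))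
trit-step φ δ diag anti forward x neg =
  subst (λ z → δ z (x + -1ℤ) ≡ φ (x + -1ℤ) - φ z) (down-up x) backward
  where
  down-up : ∀ x → x + -1ℤ + 1ℤ ≡ x
  down-up = solve-∀
  flip : ∀ a b → - (a - b) ≡ b - a
  flip = solve-∀
  backward : δ (x + -1ℤ + 1ℤ) (x + -1ℤ) ≡ φ (x + -1ℤ) - φ (x + -1ℤ + 1ℤ)
  backward = trans (anti (x + -1ℤ) _) (trans (cong -_ (forward (x + -1ℤ))) (flip (φ (x + -1ℤ + 1ℤ)) (φ (x + -1ℤ))))

-- A K₃-colouring V of the torus (ℤ / k)², cocyclic on lattice triangles, has a potential F on ℤ²;
-- its loops in direction (s₁, s₂) therefore wind linearly in (s₁, s₂).
module PlaneLoops (k : ℕ) (V : ℤ → ℤ → Fin 3)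
  (periodic₁ : ∀ a b → V (a + + k) b ≡ V a b)
  (periodic₂ : ∀ a b → V a (b + + k) ≡ V a b)
  (cocycle : ∀ a₁ a₂ b₁ b₂ c₁ c₂ → Corner a₁ b₁ c₁ → Corner a₂ b₂ c₂ →
             arc (V a₁ a₂) (V b₁ b₂) + arc (V b₁ b₂) (V c₁ c₂) ≡ arc (V a₁ a₂) (V c₁ c₂)) where

  ψ : ℤ → ℤ → ℤ → ℤ → ℤ
  ψ a₁ a₂ b₁ b₂ = arc (V a₁ a₂) (V b₁ b₂)

  horizontal : ℤ → ℤ → ℤ
  horizontal a b = ψ a b (a + 1ℤ) b

  vertical : ℤ → ℤ → ℤ
  vertical a b = ψ a b a (b + 1ℤ)

  F : ℤ → ℤ → ℤ
  F a b = ∫ (λ u → horizontal u 0ℤ) a + ∫ (vertical a) b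

  square : ∀ a b → vertical (a + 1ℤ) b - vertical a b ≡ horizontal a (b + 1ℤ) - horizontal a b
  square a b = rearrange (vertical a b) (horizontal a (b + 1ℤ)) (horizontal a b) (vertical (a + 1ℤ) b)
    (trans (cocycle a b a (b + 1ℤ) (a + 1ℤ) (b + 1ℤ) (corner-first (near-suc a)) (corner-last (near-suc b)))
      (sym (cocycle a b (a + 1ℤ) b (a + 1ℤ) (b + 1ℤ) (corner-last (near-suc a)) (corner-first (near-suc b)))))
    where
    rearrange : ∀ p q r s → p + q ≡ r + s → s - p ≡ q - r
    rearrange p q r s eq = trans (rebase p r s) (trans (cong (_- (r + p)) (sym eq)) (cancel p q r))
      where
      rebase : ∀ p r s → s - p ≡ (r + s) - (r + p)
      rebase = solve-∀
      cancel : ∀ p q r → (p + q) - (r + p) ≡ q - r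
      cancel = solve-∀

  F-vertical : ∀ a b → F a (b + 1ℤ) ≡ F a b + vertical a b
  F-vertical a b = trans (cong (λ y → ∫ (λ u → horizontal u 0ℤ) a + y) (∫-step (vertical a) b))
                         (sym (ℤP.+-assoc (∫ (λ u → horizontal u 0ℤ) a) (∫ (vertical a) b) (vertical a b)))

  ∫vertical-step : ∀ a b → ∫ (vertical (a + 1ℤ)) b ≡ ∫ (vertical a) b + (horizontal a b - horizontal a 0ℤ)
  ∫vertical-step a b = begin
    ∫ (vertical (a + 1ℤ)) b
      ≡⟨ split (∫ (vertical (a + 1ℤ)) b) (∫ (vertical a) b) (horizontal a b) ⟩
    ∫ (vertical a) b + horizontal a b + defect b
      ≡⟨ cong (λ y → ∫ (vertical a) b + horizontal a b + y) (constant-on-ℤ defect defect-step b) ⟩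
    ∫ (vertical a) b + horizontal a b + defect 0ℤ
      ≡⟨ finish (∫ (vertical a) b) (horizontal a b) (horizontal a 0ℤ) ⟩
    ∫ (vertical a) b + (horizontal a b - horizontal a 0ℤ) ∎
    where
    open ≡-Reasoning
    defect : ℤ → ℤ
    defect b = ∫ (vertical (a + 1ℤ)) b - ∫ (vertical a) b - horizontal a b
    split : ∀ J I h → J ≡ I + h + (J - I - h)
    split = solve-∀
    finish : ∀ I h h₀ → I + h + (0ℤ - 0ℤ - h₀) ≡ I + (h - h₀)
    finish = solve-∀
    regroup : ∀ J I v′ v h′ h → (J + v′) - (I + v) - h′ ≡ (J - I - h) + ((v′ - v) - (h′ - h))
    regroup = solve-∀
    defect-step : ∀ b → defect (b + 1ℤ) ≡ defect b
    defect-step b = begin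
      defect (b + 1ℤ)
        ≡⟨ cong₂ (λ x y → x - y - horizontal a (b + 1ℤ)) (∫-step (vertical (a + 1ℤ)) b) (∫-step (vertical a) b) ⟩
      (∫ (vertical (a + 1ℤ)) b + vertical (a + 1ℤ) b) - (∫ (vertical a) b + vertical a b) - horizontal a (b + 1ℤ)
        ≡⟨ regroup (∫ (vertical (a + 1ℤ)) b) (∫ (vertical a) b) (vertical (a + 1ℤ) b) (vertical a b)
                   (horizontal a (b + 1ℤ)) (horizontal a b) ⟩
      defect b + ((vertical (a + 1ℤ) b - vertical a b) - (horizontal a (b + 1ℤ) - horizontal a b))
        ≡⟨ cong (λ y → defect b + (y - (horizontal a (b + 1ℤ) - horizontal a b))) (square a b) ⟩
      defect b + ((horizontal a (b + 1ℤ) - horizontal a b) - (horizontal a (b + 1ℤ) - horizontal a b))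
        ≡⟨ cong (λ y → defect b + y) (ℤP.+-inverseʳ (horizontal a (b + 1ℤ) - horizontal a b)) ⟩
      defect b + 0ℤ
        ≡⟨ ℤP.+-identityʳ (defect b) ⟩
      defect b ∎

  F-horizontal : ∀ a b → F (a + 1ℤ) b ≡ F a b + horizontal a b
  F-horizontal a b = begin
    F (a + 1ℤ) b
      ≡⟨ cong₂ _+_ (∫-step (λ u → horizontal u 0ℤ) a) (∫vertical-step a b) ⟩
    (∫ (λ u → horizontal u 0ℤ) a + horizontal a 0ℤ) + (∫ (vertical a) b + (horizontal a b - horizontal a 0ℤ))
      ≡⟨ cancel (∫ (λ u → horizontal u 0ℤ) a) (horizontal a 0ℤ) (∫ (vertical a) b) (horizontal a b) ⟩
    F a b + horizontal a b ∎
    where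
    open ≡-Reasoning
    cancel : ∀ I h₀ J h → (I + h₀) + (J + (h - h₀)) ≡ (I + J) + h
    cancel = solve-∀

  horizontal-trit : ∀ a b s → ψ a b (a + ⟦ s ⟧) b ≡ F (a + ⟦ s ⟧) b - F a b
  horizontal-trit a b = trit-step (λ x → F x b) (λ x y → ψ x b y b) (λ x → arc-diag (V x b))
    (λ x y → arc-anti (V x b) (V y b)) (λ x → difference (F-horizontal x b)) a

  vertical-trit : ∀ a b s → ψ a b a (b + ⟦ s ⟧) ≡ F a (b + ⟦ s ⟧) - F a b
  vertical-trit a = trit-step (F a) (λ x y → ψ a x a y) (λ y → arc-diag (V a y))
    (λ x y → arc-anti (V a x) (V a y)) (λ y → difference (F-vertical a y))

  potential-step : ∀ a b s₁ s₂ → ψ a b (a + ⟦ s₁ ⟧) (b + ⟦ s₂ ⟧) ≡ F (a + ⟦ s₁ ⟧) (b + ⟦ s₂ ⟧) - F a b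
  potential-step a b s₁ s₂ = begin
    ψ a b a′ b′
      ≡⟨ cocycle a b a′ b a′ b′ (corner-last (near-step a s₁)) (corner-first (near-step b s₂)) ⟨
    ψ a b a′ b + ψ a′ b a′ b′
      ≡⟨ cong₂ _+_ (horizontal-trit a b s₁) (vertical-trit a′ b s₂) ⟩
    (F a′ b - F a b) + (F a′ b′ - F a′ b)
      ≡⟨ chain (F a b) (F a′ b) (F a′ b′) ⟩
    F a′ b′ - F a b ∎
    where
    open ≡-Reasoning
    a′ : ℤ
    a′ = a + ⟦ s₁ ⟧
    b′ : ℤ
    b′ = b + ⟦ s₂ ⟧
    chain : ∀ x y z → (y - x) + (z - y) ≡ z - x
    chain = solve-∀

  loop : Trit → Trit → ℤ
  loop s₁ s₂ = sumRange k (λ t → ψ (+ t * ⟦ s₁ ⟧) (+ t * ⟦ s₂ ⟧) (+ suc t * ⟦ s₁ ⟧) (+ suc t * ⟦ s₂ ⟧))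

  loop≡potential : ∀ s₁ s₂ → loop s₁ s₂ ≡ F (+ k * ⟦ s₁ ⟧) (+ k * ⟦ s₂ ⟧)
  loop≡potential s₁ s₂ = begin
    loop s₁ s₂                          ≡⟨ sumRange-cong k step ⟩
    sumRange k (λ t → corner (suc t) - corner t) ≡⟨ sumRange-telescope k corner ⟩
    corner k - 0ℤ                       ≡⟨ ℤP.+-identityʳ (corner k) ⟩
    corner k                            ∎
    where
    open ≡-Reasoning
    corner : ℕ → ℤ
    corner t = F (+ t * ⟦ s₁ ⟧) (+ t * ⟦ s₂ ⟧)
    next : ∀ t s → + suc t * s ≡ + t * s + s
    next t s = succ (+ t) s
      where
      succ : ∀ t s → (1ℤ + t) * s ≡ t * s + s
      succ = solve-∀
    step : ∀ t → ψ (+ t * ⟦ s₁ ⟧) (+ t * ⟦ s₂ ⟧) (+ suc t * ⟦ s₁ ⟧) (+ suc t * ⟦ s₂ ⟧) ≡ corner (suc t) - corner t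
    step t = subst₂ (λ x y → ψ (+ t * ⟦ s₁ ⟧) (+ t * ⟦ s₂ ⟧) x y ≡ F x y - corner t)
                    (sym (next t ⟦ s₁ ⟧)) (sym (next t ⟦ s₂ ⟧)) (potential-step (+ t * ⟦ s₁ ⟧) (+ t * ⟦ s₂ ⟧) s₁ s₂)

  V-multiple : ∀ s b → V (+ k * ⟦ s ⟧) b ≡ V 0ℤ b
  V-multiple pos b = trans (cong (λ a → V a b) (ℤP.*-identityʳ (+ k))) (periodic₁ 0ℤ b)
  V-multiple nul b = cong (λ a → V a b) (ℤP.*-zeroʳ (+ k))
  V-multiple neg b = begin
    V (+ k * -1ℤ) b       ≡⟨ cong (λ a → V a b) (trans (ℤP.*-comm (+ k) -1ℤ) (ℤP.-1*i≡-i (+ k))) ⟩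
    V (- + k) b           ≡⟨ periodic₁ (- + k) b ⟨
    V (- + k + + k) b     ≡⟨ cong (λ a → V a b) (ℤP.+-inverseˡ (+ k)) ⟩
    V 0ℤ b                ∎
    where open ≡-Reasoning

  F-multiple : ∀ s₁ s₂ → F (+ k * ⟦ s₁ ⟧) (+ k * ⟦ s₂ ⟧) ≡
               ⟦ s₁ ⟧ * ∫ (λ u → horizontal u 0ℤ) (+ k) + ⟦ s₂ ⟧ * ∫ (vertical 0ℤ) (+ k)
  F-multiple s₁ s₂ = cong₂ _+_ (∫-scale (+ k) horizontal-periodic s₁)
    (trans (∫-cong (λ b → cong₂ arc (V-multiple s₁ b) (V-multiple s₁ (b + 1ℤ))) (+ k * ⟦ s₂ ⟧))
           (∫-scale (+ k) vertical-periodic s₂))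
    where
    shift : ∀ u c → u + c + 1ℤ ≡ u + 1ℤ + c
    shift = solve-∀
    horizontal-periodic : ∀ u → horizontal (u + + k) 0ℤ ≡ horizontal u 0ℤ
    horizontal-periodic u = cong₂ arc (periodic₁ u 0ℤ)
      (trans (cong (λ a → V a 0ℤ) (shift u (+ k))) (periodic₁ (u + 1ℤ) 0ℤ))
    vertical-periodic : ∀ v → vertical 0ℤ (v + + k) ≡ vertical 0ℤ v
    vertical-periodic v = cong₂ arc (periodic₂ 0ℤ v)
      (trans (cong (V 0ℤ) (shift v (+ k))) (periodic₂ 0ℤ (v + 1ℤ)))

  loop-linear : ∀ s₁ s₂ → loop s₁ s₂ ≡ ⟦ s₁ ⟧ * loop pos nul + ⟦ s₂ ⟧ * loop nul pos
  loop-linear s₁ s₂ rewrite loop≡potential s₁ s₂ | loop≡potential pos nul | loop≡potential nul pos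
                          | F-multiple s₁ s₂ | F-multiple pos nul | F-multiple nul pos =
    coordinates ⟦ s₁ ⟧ ⟦ s₂ ⟧ (∫ (λ u → horizontal u 0ℤ) (+ k)) (∫ (vertical 0ℤ) (+ k))
    where
    coordinates : ∀ s₁ s₂ C₁ C₂ → s₁ * C₁ + s₂ * C₂ ≡ s₁ * (1ℤ * C₁ + 0ℤ * C₂) + s₂ * (0ℤ * C₁ + 1ℤ * C₂)
    coordinates = solve-∀

-- A lattice point A ∈ ℤⁿ stands for the vertex 2A of C_kⁿ; even vertices with nearby preimages
-- share the odd common neighbour 2m + 1.
module Doubling (k : ℕ) {{_ : NonZero k}} where
  open Cover k

  Realizes : ∀ {n} → (Fin n → Fin k) → (Fin n → ℤ) → Set
  Realizes X A = ∀ l → X l ≡ cover (+ 2 * A l)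

  window-adjacent : ∀ {m x} → InWindow m x → CAdj k (cover (+ 2 * x)) (cover (+ 2 * m + 1ℤ))
  window-adjacent {m} (inj₁ refl) = cover-adjacent (+ 2 * m)
  window-adjacent {m} (inj₂ refl) =
    subst (λ y → CAdj k (cover y) (cover (+ 2 * m + 1ℤ))) (two-steps m) (CAdj-sym (cover-adjacent (+ 2 * m + 1ℤ)))
    where
    two-steps : ∀ m → + 2 * m + 1ℤ + 1ℤ ≡ + 2 * (m + 1ℤ)
    two-steps = solve-∀

  Cocyclic : ∀ {n} → ((Fin n → Fin k) → Fin 3) → Set
  Cocyclic {n} G = ∀ (X Y W : Fin n → Fin k) (A B C : Fin n → ℤ) →
    Realizes X A → Realizes Y B → Realizes W C → (∀ l → Corner (A l) (B l) (C l)) →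
    arc (G X) (G Y) + arc (G Y) (G W) ≡ arc (G X) (G W)

  pol-cocyclic : ∀ {n} {g : Op (Fin k) (Fin 3) n} → IsPol k g → Cocyclic g
  pol-cocyclic {n} {g} pol X Y W A B C X≈A Y≈B W≈C corner =
    arc-cocycle (pol X Z (adjacent X≈A (proj₁ ∘ windows)))
                (pol Y Z (adjacent Y≈B (proj₁ ∘ proj₂ ∘ windows)))
                (pol W Z (adjacent W≈C (proj₂ ∘ proj₂ ∘ windows)))
    where
    centre : Fin n → ℤ
    centre l = proj₁ (corner-window (corner l))
    windows : ∀ l → InWindow (centre l) (A l) × InWindow (centre l) (B l) × InWindow (centre l) (C l)
    windows l = proj₂ (corner-window (corner l))
    Z : Fin n → Fin k
    Z l = cover (+ 2 * centre l + 1ℤ)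
    adjacent : ∀ {V D} → Realizes V D → (∀ l → InWindow (centre l) (D l)) → PowAdj k n V Z
    adjacent V≈D D∈window l = subst (λ v → CAdj k v (Z l)) (sym (V≈D l)) (window-adjacent (D∈window l))

  Extensional : ∀ {n} → ((Fin n → Fin k) → Fin 3) → Set
  Extensional {n} G = ∀ X Y → (∀ l → X l ≡ Y l) → G X ≡ G Y

  walkSum : ∀ {n} → ((Fin n → Fin k) → Fin 3) → (ℕ → Fin n → Fin k) → ℤ
  walkSum G P = sumRange k (λ t → arc (G (P t)) (G (P (suc t))))

  walkSum-cong : ∀ {n} {G : (Fin n → Fin k) → Fin 3} → Extensional G →
                 ∀ {P Q} → (∀ t l → P t l ≡ Q t l) → walkSum G P ≡ walkSum G Q
  walkSum-cong ext P≈Q = sumRange-cong k (λ t → cong₂ arc (ext _ _ (P≈Q t)) (ext _ _ (P≈Q (suc t))))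

  loopPoint : ∀ {n} → (Fin n → Trit) → ℕ → Fin n → Fin k
  loopPoint ε t l = cover (+ 2 * (+ t * ⟦ ε l ⟧))

  loopSum : ∀ {n} → ((Fin n → Fin k) → Fin 3) → (Fin n → Trit) → ℤ
  loopSum G ε = walkSum G (loopPoint ε)

  module Slice {n} (G : (Fin (suc n) → Fin k) → Fin 3) (ext : Extensional G) (cocyclic : Cocyclic G)
               (ε : Fin (suc n) → Trit) where

    lift : ℤ → ℤ → Fin (suc n) → ℤ
    lift a b = a ∷ (λ l → ⟦ ε (fsuc l) ⟧ * b)

    V : ℤ → ℤ → Fin 3
    V a b = G (λ l → cover (+ 2 * lift a b l))

    periodic₁ : ∀ a b → V (a + + k) b ≡ V a b
    periodic₁ a b = ext _ _ λ
      { fzero → trans (cong cover (spread a (+ k))) (cover-periodic (+ 2 * a) (+ 2))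
      ; (fsuc l) → refl }
      where
      spread : ∀ a c → + 2 * (a + c) ≡ + 2 * a + + 2 * c
      spread = solve-∀

    periodic₂ : ∀ a b → V a (b + + k) ≡ V a b
    periodic₂ a b = ext _ _ λ
      { fzero → refl
      ; (fsuc l) → trans (cong cover (spread ⟦ ε (fsuc l) ⟧ b (+ k)))
                         (cover-periodic (+ 2 * (⟦ ε (fsuc l) ⟧ * b)) (+ 2 * ⟦ ε (fsuc l) ⟧)) }
      where
      spread : ∀ s b c → + 2 * (s * (b + c)) ≡ + 2 * (s * b) + (+ 2 * s) * c
      spread = solve-∀

    cocycle : ∀ a₁ a₂ b₁ b₂ c₁ c₂ → Corner a₁ b₁ c₁ → Corner a₂ b₂ c₂ →
              arc (V a₁ a₂) (V b₁ b₂) + arc (V b₁ b₂) (V c₁ c₂) ≡ arc (V a₁ a₂) (V c₁ c₂)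
    cocycle a₁ a₂ b₁ b₂ c₁ c₂ corner₁ corner₂ =
      cocyclic _ _ _ (lift a₁ a₂) (lift b₁ b₂) (lift c₁ c₂) (λ _ → refl) (λ _ → refl) (λ _ → refl)
        λ { fzero → corner₁ ; (fsuc l) → corner-scale (ε (fsuc l)) corner₂ }

    open PlaneLoops k V periodic₁ periodic₂ cocycle public using (loop; loop-linear)

    private
      scaled : ∀ (t s : ℤ) → + 2 * (t * s) ≡ + 2 * (s * (t * 1ℤ))
      scaled = solve-∀
      vanishing : ∀ (t s : ℤ) → + 2 * (t * 0ℤ) ≡ + 2 * (s * (t * 0ℤ))
      vanishing = solve-∀
      origin : ∀ (t : ℤ) → + 2 * (t * 0ℤ) ≡ 0ℤ
      origin = solve-∀

    loop-direction : loop (ε fzero) pos ≡ loopSum G ε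
    loop-direction = walkSum-cong ext λ t →
      λ { fzero → refl ; (fsuc l) → cong cover (sym (scaled (+ t) ⟦ ε (fsuc l) ⟧)) }

    loop-first-axis : loop pos nul ≡ loopSum G (unit fzero)
    loop-first-axis = walkSum-cong ext λ t →
      λ { fzero → refl ; (fsuc l) → cong cover (sym (vanishing (+ t) ⟦ ε (fsuc l) ⟧)) }

    loop-other-axes : loop nul pos ≡ loopSum (G ∘ (cover 0ℤ ∷_)) (ε ∘ fsuc)
    loop-other-axes = walkSum-cong ext λ t →
      λ { fzero → cong cover (origin (+ t)) ; (fsuc l) → cong cover (sym (scaled (+ t) ⟦ ε (fsuc l) ⟧)) }

  extensional-∷ : ∀ {n} {G : (Fin (suc n) → Fin k) → Fin 3} x → Extensional G → Extensional (G ∘ (x ∷_))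
  extensional-∷ x ext X Y X≈Y = ext _ _ λ { fzero → refl ; (fsuc l) → X≈Y l }

  cocyclic-∷ : ∀ {n} {G : (Fin (suc n) → Fin k) → Fin 3} → Cocyclic G → Cocyclic (G ∘ (cover 0ℤ ∷_))
  cocyclic-∷ cocyclic X Y W A B C X≈A Y≈B W≈C corner =
    cocyclic _ _ _ (0ℤ ∷ A) (0ℤ ∷ B) (0ℤ ∷ C)
      (λ { fzero → refl ; (fsuc l) → X≈A l }) (λ { fzero → refl ; (fsuc l) → Y≈B l })
      (λ { fzero → refl ; (fsuc l) → W≈C l }) (λ { fzero → corner-first (near-refl 0ℤ) ; (fsuc l) → corner l })

  loopSum-∷ : ∀ {n} {G : (Fin (suc n) → Fin k) → Fin 3} → Extensional G →
              ∀ j → loopSum (G ∘ (cover 0ℤ ∷_)) (unit j) ≡ loopSum G (unit (fsuc j))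
  loopSum-∷ ext j = walkSum-cong ext λ t → λ { fzero → cong cover (sym (origin (+ t))) ; (fsuc l) → refl }
    where
    origin : ∀ t → + 2 * (t * 0ℤ) ≡ 0ℤ
    origin = solve-∀

  loopSum-linear : ∀ {n} (G : (Fin n → Fin k) → Fin 3) → Extensional G → Cocyclic G →
                   ∀ ε → loopSum G ε ≡ Σℤ n (λ l → ⟦ ε l ⟧ * loopSum G (unit l))
  loopSum-linear {zero} G ext cocyclic ε =
    sumRange-zero k (λ t → trans (cong (arc (G (loopPoint ε t))) (ext _ _ λ ())) (arc-diag _))
  loopSum-linear {suc n} G ext cocyclic ε = begin
    loopSum G ε
      ≡⟨ loop-direction ⟨
    loop (ε fzero) pos
      ≡⟨ loop-linear (ε fzero) pos ⟩
    ⟦ ε fzero ⟧ * loop pos nul + 1ℤ * loop nul pos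
      ≡⟨ cong₂ (λ x y → ⟦ ε fzero ⟧ * x + y) loop-first-axis (trans (ℤP.*-identityˡ _) loop-other-axes) ⟩
    ⟦ ε fzero ⟧ * loopSum G (unit fzero) + loopSum G′ (ε ∘ fsuc)
      ≡⟨ cong (λ y → first + y) (loopSum-linear G′ (extensional-∷ _ ext) (cocyclic-∷ cocyclic) (ε ∘ fsuc)) ⟩
    first + Σℤ n (λ l → ⟦ ε (fsuc l) ⟧ * loopSum G′ (unit l))
      ≡⟨ cong (λ y → first + y) (Σℤ-cong n (λ l → cong (⟦ ε (fsuc l) ⟧ *_) (loopSum-∷ ext l))) ⟩
    Σℤ (suc n) (λ l → ⟦ ε l ⟧ * loopSum G (unit l)) ∎
    where
    open ≡-Reasoning
    open Slice G ext cocyclic ε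
    G′ : (Fin n → Fin k) → Fin 3
    G′ = G ∘ (cover 0ℤ ∷_)
    first : ℤ
    first = ⟦ ε fzero ⟧ * loopSum G (unit fzero)

  cover-multiples-adjacent : ∀ s t → t ≢ nul → CAdj k (cover (+ s * ⟦ t ⟧)) (cover (+ suc s * ⟦ t ⟧))
  cover-multiples-adjacent s pos _ =
    subst (λ z → CAdj k (cover (+ s * 1ℤ)) (cover z)) (up (+ s)) (cover-adjacent (+ s * 1ℤ))
    where
    up : ∀ S → S * 1ℤ + 1ℤ ≡ (1ℤ + S) * 1ℤ
    up = solve-∀
  cover-multiples-adjacent s nul t≢nul = ⊥-elim (t≢nul refl)
  cover-multiples-adjacent s neg _ =
    subst (λ z → CAdj k (cover z) (cover (+ suc s * -1ℤ))) (down (+ s)) (CAdj-sym (cover-adjacent (+ suc s * -1ℤ)))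
    where
    down : ∀ S → (1ℤ + S) * -1ℤ + 1ℤ ≡ S * -1ℤ
    down = solve-∀

  module _ (k-odd : k ℕ.% 2 ≡ 1) {n} (G : (Fin n → Fin k) → Fin 3) (ext : Extensional G) (pol : IsPol k G)
           (ε : Fin n → Trit) (ε≢nul : ∀ l → ε l ≢ nul) where

    -- The loop through 2tε, t < k, is every other vertex of the closed walk s ↦ sε, s < 2k, in C_kⁿ.
    private
      walk : ℕ → Fin 3
      walk s = G (λ l → cover (+ s * ⟦ ε l ⟧))

      walk-adjacent : ∀ s → CAdj 3 (walk s) (walk (suc s))
      walk-adjacent s = pol _ _ (λ l → cover-multiples-adjacent s (ε l) (ε≢nul l))

      step : ℕ → ℤ
      step s = arc (walk s) (walk (suc s))

      walk-periodic : ∀ s → walk (k ℕ.+ s) ≡ walk s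
      walk-periodic s = ext _ _ λ l → trans (cong cover (shift (+ k) (+ s) ⟦ ε l ⟧)) (cover-periodic (+ s * ⟦ ε l ⟧) ⟦ ε l ⟧)
        where
        shift : ∀ c S x → (c + S) * x ≡ S * x + x * c
        shift = solve-∀

      step-periodic : ∀ s → step (k ℕ.+ s) ≡ step s
      step-periodic s = cong₂ arc (walk-periodic s) (trans (cong walk (sym (ℕP.+-suc k s))) (walk-periodic (suc s)))

      double-loopSum : + 2 * loopSum G ε ≡ + 2 * - sumRange k step
      double-loopSum = begin
        + 2 * loopSum G ε
          ≡⟨ *-distribˡ-sumRange k (+ 2) _ ⟩
        sumRange k (λ t → + 2 * arc (G (loopPoint ε t)) (G (loopPoint ε (suc t))))
          ≡⟨ sumRange-cong k (λ t → trans (cong₂ (λ a b → + 2 * arc a b) (even t) (odd t))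
                                          (arc-double (walk-adjacent (t ℕ.+ t)) (walk-adjacent (suc (t ℕ.+ t))))) ⟩
        sumRange k (λ t → - (step (t ℕ.+ t) + step (suc (t ℕ.+ t))))
          ≡⟨ sumRange-neg k (λ t → step (t ℕ.+ t) + step (suc (t ℕ.+ t))) ⟩
        - sumRange k (λ t → step (t ℕ.+ t) + step (suc (t ℕ.+ t)))
          ≡⟨ cong -_ (sumRange-pairs k step) ⟩
        - sumRange (k ℕ.+ k) step
          ≡⟨ cong -_ (trans (sumRange-+ k k step) (cong (λ y → sumRange k step + y) (sumRange-cong k step-periodic))) ⟩
        - (sumRange k step + sumRange k step)
          ≡⟨ twice (sumRange k step) ⟩
        + 2 * - sumRange k step ∎
        where
        open ≡-Reasoning
        halve : ∀ T x → + 2 * (T * x) ≡ (T + T) * x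
        halve = solve-∀
        halve-suc : ∀ T x → + 2 * ((1ℤ + T) * x) ≡ (1ℤ + (1ℤ + (T + T))) * x
        halve-suc = solve-∀
        twice : ∀ x → - (x + x) ≡ + 2 * - x
        twice = solve-∀
        even : ∀ t → G (loopPoint ε t) ≡ walk (t ℕ.+ t)
        even t = ext _ _ (λ l → cong cover (halve (+ t) ⟦ ε l ⟧))
        odd : ∀ t → G (loopPoint ε (suc t)) ≡ walk (suc (suc (t ℕ.+ t)))
        odd t = ext _ _ (λ l → cong cover (halve-suc (+ t) ⟦ ε l ⟧))

    loopSum-odd : Odd (loopSum G ε)
    loopSum-odd = subst Odd (sym (ℤP.*-cancelˡ-≡ (+ 2) _ _ double-loopSum))
      (odd-neg (odd-sumRange-±1 k step k-odd (λ s → arc-±1 (K₃-adjacent⇒≢ (walk-adjacent s)))))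

-- Polymorphisms need not respect pointwise equality of tuples; g ∘ normalize does, and normalized
-- tuples realize the same lattice points, so g and g ∘ normalize can be compared inside a triangle.
module Winding (k′ : ℕ) where
  private
    k : ℕ
    k = suc k′

  open Cover k
  open Doubling k

  normalize : ∀ {n} → (Fin n → Fin k) → Fin n → Fin k
  normalize X = lookup (tabulate X)

  normalize-≗ : ∀ {n} (X : Fin n → Fin k) l → normalize X l ≡ X l
  normalize-≗ X = VecP.lookup∘tabulate X

  normalized-extensional : ∀ {n} (g : Op (Fin k) (Fin 3) n) → Extensional (g ∘ normalize)
  normalized-extensional g X Y X≈Y = cong (g ∘ lookup) (VecP.tabulate-cong X≈Y)

  normalized-pol : ∀ {n} {g : Op (Fin k) (Fin 3) n} → IsPol k g → IsPol k (g ∘ normalize)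
  normalized-pol pol X Y X~Y =
    pol _ _ λ l → subst₂ (CAdj k) (sym (normalize-≗ X l)) (sym (normalize-≗ Y l)) (X~Y l)

  realizes-normalize : ∀ {n} {X : Fin n → Fin k} {A} → Realizes X A → Realizes (normalize X) A
  realizes-normalize {X = X} X≈A l = trans (normalize-≗ X l) (X≈A l)

  module _ {n} {g : Op (Fin k) (Fin 3) n} (pol : IsPol k g) where

    drift : (Fin n → Fin k) → ℤ
    drift X = arc (g X) (g (normalize X))

    arc-normalize : ∀ {X Y A B} → Realizes X A → Realizes Y B → (∀ l → Near (A l) (B l)) →
                    arc (g X) (g Y) ≡ drift X + arc (g (normalize X)) (g (normalize Y)) - drift Y
    arc-normalize {X} {Y} {A} {B} X≈A Y≈B near = begin
      arc (g X) (g Y)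
        ≡⟨ pol-cocyclic pol X (normalize X) Y A A B X≈A (realizes-normalize {A = A} X≈A) Y≈B (corner-first ∘ near) ⟨
      drift X + arc (g (normalize X)) (g Y)
        ≡⟨ cong (λ z → drift X + z) (pol-cocyclic pol (normalize X) (normalize Y) Y A B B
                   (realizes-normalize {A = A} X≈A) (realizes-normalize {A = B} Y≈B) Y≈B (corner-last ∘ near)) ⟨
      drift X + (arc (g (normalize X)) (g (normalize Y)) + arc (g (normalize Y)) (g Y))
        ≡⟨ cong (λ z → drift X + (arc (g (normalize X)) (g (normalize Y)) + z)) (arc-anti (g Y) (g (normalize Y))) ⟩
      drift X + (arc (g (normalize X)) (g (normalize Y)) + - drift Y)
        ≡⟨ ℤP.+-assoc (drift X) _ (- drift Y) ⟨
      drift X + arc (g (normalize X)) (g (normalize Y)) - drift Y ∎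
      where open ≡-Reasoning

    closedSum-normalize : (P : ℕ → Fin n → Fin k) (A : ℕ → Fin n → ℤ) →
      (∀ t → Realizes (P t) (A t)) → (∀ t l → Near (A t l) (A (suc t) l)) → Realizes (P 0) (A k) →
      closedSum k′ arc (g ∘ P) ≡ walkSum (g ∘ normalize) P
    closedSum-normalize P A P≈A near closes = begin
      closedSum k′ arc (g ∘ P)
        ≡⟨ cong₂ _+_ (sumRange-cong k′ λ t → trans (arc-normalize (P≈A t) (P≈A (suc t)) (near t))
                                                    (regroup (D t) (y t) (D (suc t))))
                     (arc-normalize (P≈A k′) closes (near k′)) ⟩
      sumRange k′ (λ t → y t + (- D (suc t) - - D t)) + (D k′ + arc (G (P k′)) (G (P 0)) - D 0)
        ≡⟨ cong₂ _+_ (trans (sumRange-distrib-+ k′ y (λ t → - D (suc t) - - D t))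
                            (cong (λ z → sumRange k′ y + z) (sumRange-telescope k′ (λ t → - D t))))
                     (cong (λ z → D k′ + arc (G (P k′)) z - D 0) closing) ⟩
      (sumRange k′ y + (- D k′ - - D 0)) + (D k′ + y k′ - D 0)
        ≡⟨ cancel (sumRange k′ y) (D k′) (D 0) (y k′) ⟩
      sumRange k′ y + y k′ ∎
      where
      open ≡-Reasoning
      G : (Fin n → Fin k) → Fin 3
      G = g ∘ normalize
      D : ℕ → ℤ
      D t = drift (P t)
      y : ℕ → ℤ
      y t = arc (G (P t)) (G (P (suc t)))
      regroup : ∀ d x d′ → d + x - d′ ≡ x + (- d′ - - d)
      regroup = solve-∀
      cancel : ∀ S d d₀ x → (S + (- d - - d₀)) + (d + x - d₀) ≡ S + x
      cancel = solve-∀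
      closing : G (P 0) ≡ G (P k)
      closing = normalized-extensional g _ _ λ l → trans (closes l) (sym (P≈A k l))

  winding : ∀ {n} → Op (Fin k) (Fin 3) n → (Fin n → Trit) → ℤ
  winding g ε = closedSum k′ wrap (g ∘ loopPoint ε)

  3*winding : ∀ {n} {g : Op (Fin k) (Fin 3) n} → IsPol k g →
              ∀ ε → + 3 * winding g ε ≡ loopSum (g ∘ normalize) ε
  3*winding {g = g} pol ε = trans (sym (closedSum-arc k′ (g ∘ loopPoint ε)))
    (closedSum-normalize pol (loopPoint ε) (λ t l → + t * ⟦ ε l ⟧) (λ t l → refl) near-next closes)
    where
    succ : ∀ t x → t * x + x ≡ (1ℤ + t) * x
    succ = solve-∀
    near-next : ∀ t l → Near (+ t * ⟦ ε l ⟧) (+ suc t * ⟦ ε l ⟧)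
    near-next t l = subst (Near (+ t * ⟦ ε l ⟧)) (succ (+ t) ⟦ ε l ⟧) (near-step (+ t * ⟦ ε l ⟧) (ε l))
    full-turn : ∀ c x → + 2 * (c * x) ≡ 0ℤ + (+ 2 * x) * c
    full-turn = solve-∀
    closes : Realizes (loopPoint ε 0) (λ l → + k * ⟦ ε l ⟧)
    closes l = sym (trans (cong cover (full-turn (+ k) ⟦ ε l ⟧)) (cover-periodic 0ℤ (+ 2 * ⟦ ε l ⟧)))

  winding-linear : ∀ {n} {g : Op (Fin k) (Fin 3) n} → IsPol k g →
                   ∀ ε → winding g ε ≡ Σℤ n (λ l → ⟦ ε l ⟧ * winding g (unit l))
  winding-linear {n} {g} pol ε = ℤP.*-cancelˡ-≡ (+ 3) _ _ (begin
    + 3 * winding g ε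
      ≡⟨ 3*winding pol ε ⟩
    loopSum G ε
      ≡⟨ loopSum-linear G (normalized-extensional g) (pol-cocyclic (normalized-pol pol)) ε ⟩
    Σℤ n (λ l → ⟦ ε l ⟧ * loopSum G (unit l))
      ≡⟨ Σℤ-cong n (λ l → cong (⟦ ε l ⟧ *_) (3*winding pol (unit l))) ⟨
    Σℤ n (λ l → ⟦ ε l ⟧ * (+ 3 * winding g (unit l)))
      ≡⟨ Σℤ-cong n (λ l → rotate ⟦ ε l ⟧ (winding g (unit l))) ⟩
    Σℤ n (λ l → + 3 * (⟦ ε l ⟧ * winding g (unit l)))
      ≡⟨ *-distribˡ-Σℤ n (+ 3) _ ⟨
    + 3 * Σℤ n (λ l → ⟦ ε l ⟧ * winding g (unit l)) ∎)
    where
    open ≡-Reasoning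
    G : (Fin n → Fin k) → Fin 3
    G = g ∘ normalize
    rotate : ∀ s w → s * (+ 3 * w) ≡ + 3 * (s * w)
    rotate = solve-∀

  winding-odd : k ℕ.% 2 ≡ 1 → ∀ {n} {g : Op (Fin k) (Fin 3) n} → IsPol k g →
                ∀ ε → (∀ l → ε l ≢ nul) → Odd (winding g ε)
  winding-odd k-odd {g = g} pol ε ε≢nul = odd-3* (winding g ε) (subst Odd (sym (3*winding pol ε))
    (loopSum-odd k-odd (g ∘ normalize) (normalized-extensional g) (normalized-pol pol) ε ε≢nul))

  3∣winding∣≤k : ∀ {n} (g : Op (Fin k) (Fin 3) n) ε → 3 ℕ.* ∣ winding g ε ∣ ℕ.≤ k
  3∣winding∣≤k g ε = begin
    3 ℕ.* ∣ winding g ε ∣                  ≡⟨ ℤP.∣i*j∣≡∣i∣*∣j∣ (+ 3) (winding g ε) ⟨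
    ∣ + 3 * winding g ε ∣                  ≡⟨ cong ∣_∣ (closedSum-arc k′ (g ∘ loopPoint ε)) ⟨
    ∣ closedSum k′ arc (g ∘ loopPoint ε) ∣ ≤⟨ ∣closedSum-arc∣≤ k′ (g ∘ loopPoint ε) ⟩
    k                                      ∎
    where open ℕP.≤-Reasoning

  module _ (N : ℕ) (k-odd : k ℕ.% 2 ≡ 1) (N-odd : N ℕ.% 2 ≡ 1) (k<3[N+2] : k ℕ.< 3 ℕ.* (N ℕ.+ 2)) where

    coefficient : ∀ {n} → Op (Fin k) (Fin 3) n → Fin n → ℤ
    coefficient g i = winding g (unit i)

    signum : ℤ → Trit
    signum (+ _)    = pos
    signum -[1+ _ ] = neg

    ⟦signum⟧* : ∀ c → ⟦ signum c ⟧ * c ≡ + ∣ c ∣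
    ⟦signum⟧* (+ n)    = ℤP.*-identityˡ (+ n)
    ⟦signum⟧* -[1+ n ] = ℤP.-1*i≡-i -[1+ n ]

    signum≢nul : ∀ c → signum c ≢ nul
    signum≢nul (+ _)    ()
    signum≢nul -[1+ _ ] ()

    Σ∣coefficient∣≤N : ∀ {n} {g : Op (Fin k) (Fin 3) n} → IsPol k g →
                       Σℕ n (λ i → ∣ coefficient g i ∣) ℕ.≤ N
    Σ∣coefficient∣≤N {n} {g} pol = odd-≤ s-odd N-odd (ℕP.*-cancelˡ-< 3 s (N ℕ.+ 2) (ℕP.≤-<-trans 3s≤k k<3[N+2]))
      where
      s : ℕ
      s = Σℕ n (λ i → ∣ coefficient g i ∣)
      σ : Fin n → Trit
      σ = signum ∘ coefficient g
      winding≡s : winding g σ ≡ + s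
      winding≡s = trans (winding-linear pol σ) (trans (Σℤ-cong n (⟦signum⟧* ∘ coefficient g)) (Σℤ-pos n _))
      s-odd : s ℕ.% 2 ≡ 1
      s-odd = odd-∣ subst Odd winding≡s (winding-odd k-odd pol σ (signum≢nul ∘ coefficient g)) ∣
      3s≤k : 3 ℕ.* s ℕ.≤ k
      3s≤k = subst (λ w → 3 ℕ.* ∣ w ∣ ℕ.≤ k) winding≡s (3∣winding∣≤k g σ)

    Σcoefficient-odd : ∀ {n} {g : Op (Fin k) (Fin 3) n} → IsPol k g →
                       ∣ Σℤ n (coefficient g) ∣ ℕ.% 2 ≡ 1
    Σcoefficient-odd {n} {g} pol = odd-∣ subst Odd
      (trans (winding-linear pol (λ _ → pos)) (Σℤ-cong n (ℤP.*-identityˡ ∘ coefficient g)))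
      (winding-odd k-odd pol (λ _ → pos) (λ _ ())) ∣

    linearForm : ∀ {n} → Op (Fin k) (Fin 3) n → Op ℤ ℤ n
    linearForm {n} g x = Σℤ n (λ i → coefficient g i * x i)

    linearForm-minor : ∀ {m n} {g : Op (Fin k) (Fin 3) m} → IsPol k g → ∀ (π : Fin m → Fin n) x →
                       linearForm (minor g π) x ≡ minor (linearForm g) π x
    linearForm-minor {m} {n} {g} pol π x = begin
      Σℤ n (λ j → coefficient (minor g π) j * x j)
        ≡⟨ Σℤ-cong n (λ j → cong (_* x j) (winding-linear pol (unit j ∘ π))) ⟩
      Σℤ n (λ j → Σℤ m (λ i → ⟦ unit j (π i) ⟧ * coefficient g i) * x j)
        ≡⟨ Σℤ-transpose m n (λ i j → ⟦ unit j (π i) ⟧) (coefficient g) x ⟩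
      Σℤ m (λ i → coefficient g i * Σℤ n (λ j → ⟦ unit j (π i) ⟧ * x j))
        ≡⟨ Σℤ-cong m (λ i → cong (coefficient g i *_) (Σℤ-unit n x (π i))) ⟩
      Σℤ m (λ i → coefficient g i * x (π i)) ∎
      where open ≡-Reasoning

    minionHom : MinionHom k N
    minionHom = record
      { ξ       = λ g _ → linearForm g
      ; ξ-in    = λ g pol → coefficient g , Σ∣coefficient∣≤N pol , Σcoefficient-odd pol , (λ _ → refl)
      ; ξ-ext   = λ {n} g g′ _ _ g≗g′ x → Σℤ-cong (suc n) (λ i → cong (_* x i)
                    (closedSum-cong k′ wrap (λ t → g≗g′ (loopPoint (unit i) t))))
      ; ξ-minor = λ g pol → linearForm-minor pol
      }

-- Only k < 3(N + 2) is needed; 3N ≤ k merely says that N is the largest such odd number.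
theorem3p3 : (k : ℕ) {{_ : NonZero k}} → 3 ℕ.≤ k → k ℕ.% 2 ≡ 1 →
    (N : ℕ) → N ℕ.% 2 ≡ 1 → 3 ℕ.* N ℕ.≤ k → k ℕ.< 3 ℕ.* (N ℕ.+ 2) →
    MinionHom k N
theorem3p3 (suc k′) _ k-odd N N-odd _ k<3[N+2] = Winding.minionHom k′ N k-odd N-odd k<3[N+2]
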